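{- The map $W\mapsto(P(W),Q(W))$ is a bijection between injective words over $\overline{\mathbb{Z}}$ and pairs $(P,Q)$ such that, for some common indexed forest $F$, $P\in\mathsf{LBS}(F)$ and $Q$ is a decreasing labeling of $F$.
   Context: Indexed forests: for a finite $S\subset\mathbb{Z}$ with maximal consecutive blocks $I_1<\cdots<I_k$, an indexed forest $F$ with support $\mathrm{Supp}(F)=S$ consists of plane binary trees $T_1,\dots,T_k$, $T_j$ having $|I_j|$ nodes canonically labeled by $I_j$ in inorder. $\operatorname{IN}(F)$ is the set of nodes. $\mathrm{INT}(u,F)$ is the set of canonical labels of the subtree rooted at $u$. $\overline{\mathbb{Z}}$ is the set of symbols $(i,j)$, $i\in\mathbb{Z}$, $j\ge1$, totally ordered lexicographically, with $\mathrm{val}(i,j)=i$. A word is injective if its letters are pairwise distinct. $\mathsf{LBS}(F)$ is the set of injective $\rho:\operatorname{IN}(F)\to\overline{\mathbb{Z}}$ with $\rho(v)<\rho(u)$ for $v$ the left child of $u$, $\rho(u)<\rho(v)$ for $v$ the right child of $u$, and $\mathrm{val}(\rho(u))\in\mathrm{INT}(u,F)$. A decreasing labeling of $F$ is a bijection $\operatorname{IN}(F)\to\{1,\dots,|F|\}$ in which each node has a larger label than its children. Insertion: for $W$ empty, $F(W)$ is empty. For $W=W'a$, let $F'=F(W')$ have blocks $I_1<\cdots<I_k$, roots $u_j$ and root labels $a_j=P(W')(u_j)$, and let $i=\mathrm{val}(a)$. Add a new root $u$ as follows. (i) If $i\notin\mathrm{Supp}(F')$: $u$ gets canonical label $i$;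 its left child is $u_j$ if $i-1\in I_j$ (else none), and its right child is $u_{j'}$ if $i+1\in I_{j'}$ (else none). (ii) If $i\in I_j$ and $a>a_j$: the left child of $u$ is $u_j$ and the right child is $u_{j+1}$ if $\max I_j+2\in\mathrm{Supp}(F')$ (else none). The support becomes $\mathrm{Supp}(F')\cup\{\max I_j+1\}$. (iii) If $i\in I_j$ and $a<a_j$: the right child of $u$ is $u_j$ and the left child is $u_{j-1}$ if $\min I_j-2\in\mathrm{Supp}(F')$ (else none). The support becomes $\mathrm{Supp}(F')\cup\{\min I_j-1\}$. Other trees are unchanged. $P(W)$ extends $P(W')$ by $u\mapsto a$, and $Q(W)$ extends $Q(W')$ by $u\mapsto|W|$. -}

module Defs where

open import Data.Bool using (Bool; true; false; if_then_else_; _∧_; not)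
open import Data.Nat as ℕ using (ℕ; zero; suc)
open import Data.Integer as ℤ using (ℤ; +_)
open import Data.Product using (_×_; _,_; proj₁; proj₂; Σ)
open import Data.Sum using (_⊎_)
open import Data.Unit using (⊤; tt)
open import Data.Empty using (⊥)
open import Data.Maybe using (Maybe; just; nothing; maybe)
open import Data.List using (List; []; _∷_; _++_; map; length; upTo; concatMap; filter)
open import Data.List.Relation.Unary.All using (All)
open import Data.List.Relation.Unary.Unique.Propositional using (Unique)
open import Data.List.Relation.Binary.Permutation.Propositional using (_↭_)
open import Relation.Binary.PropositionalEquality using (_≡_)
open import Relation.Nullary using (Dec; yes; no; does; ¬?)
open import Relation.Nullary.Decidable using (_⊎-dec_; _×-dec_)

-- The alphabet  Z̄ = { (i , j) : i ∈ ℤ , j ≥ 1 }, ordered lexicographically.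
-- The symbol (i , j) is represented by  ⟨ i , k ⟩  with  j = k + 1.

record Zbar : Set where
  constructor ⟨_,_⟩
  field
    val : ℤ
    idx : ℕ

open Zbar public

_<Z̄_ : Zbar → Zbar → Set
x <Z̄ y = (val x ℤ.< val y) ⊎ ((val x ≡ val y) × (idx x ℕ.< idx y))

_<Z̄?_ : (x y : Zbar) → Dec (x <Z̄ y)
x <Z̄? y = (val x ℤ.<? val y) ⊎-dec ((val x ℤ.≟ val y) ×-dec (idx x ℕ.<? idx y))

data Tree (A : Set) : Set where
  leaf : Tree A
  node : Tree A → A → Tree A → Tree A

size : {A : Set} → Tree A → ℕ
size leaf = 0
size (node l _ r) = size l ℕ.+ suc (size r)

inorder : {A : Set} → Tree A → List A
inorder leaf = []
inorder (node l a r) = inorder l ++ (a ∷ inorder r)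

mapTree : {A B : Set} → (A → B) → Tree A → Tree B
mapTree f leaf = leaf
mapTree f (node l a r) = node (mapTree f l) (f a) (mapTree f r)

-- A block is (s , T): a tree T whose nodes carry the canonical labels
-- s, s+1, ..., s + size T - 1 in inorder.  A forest is the list of its
-- blocks, in increasing order.  A node's canonical label is thus
-- determined by its inorder position; decorations (of type A) record
-- a labeling IN(F) → A.

Block : Set → Set
Block A = ℤ × Tree A

Forest : Set → Set
Forest A = List (Block A)

mapForest : {A B : Set} → (A → B) → Forest A → Forest B
mapForest f = map (λ b → proj₁ b , mapTree f (proj₂ b))

shape : {A : Set} → Forest A → Forest ⊤
shape = mapForest (λ _ → tt)

labels : {A : Set} → Forest A → List A
labels = concatMap (λ b → inorder (proj₂ b))

nxt : {A : Set} → Block A → ℤ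
nxt (s , t) = s ℤ.+ + size t

NonEmptyTree : {A : Set} → Tree A → Set
NonEmptyTree leaf = ⊥
NonEmptyTree (node _ _ _) = ⊤

-- consecutive blocks are separated by a gap (maximal consecutive blocks)
Separated : {A : Set} → Forest A → Set
Separated [] = ⊤
Separated (b ∷ []) = ⊤
Separated (b ∷ b′ ∷ bs) = (nxt b ℤ.< proj₁ b′) × Separated (b′ ∷ bs)

IsIndexedForest : Forest ⊤ → Set
IsIndexedForest F = All (λ b → NonEmptyTree (proj₂ b)) F × Separated F

LeftOK : Tree Zbar → Zbar → Set
LeftOK leaf a = ⊤
LeftOK (node _ b _) a = b <Z̄ a

RightOK : Zbar → Tree Zbar → Set
RightOK a leaf = ⊤
RightOK a (node _ b _) = a <Z̄ b

-- the subtree (first argument = smallest canonical label in the subtree)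
LBSTree : ℤ → Tree Zbar → Set
LBSTree s leaf = ⊤
LBSTree s (node l a r) =
  LBSTree s l × LBSTree (s ℤ.+ + suc (size l)) r
  × LeftOK l a × RightOK a r
  × (s ℤ.≤ val a) × (val a ℤ.< s ℤ.+ + size (node l a r))

LBS : Forest Zbar → Set
LBS P = All (λ b → LBSTree (proj₁ b) (proj₂ b)) P × Unique (labels P)

Below : Tree ℕ → ℕ → Set
Below leaf q = ⊤
Below (node _ q′ _) q = q′ ℕ.< q

HeapTree : Tree ℕ → Set
HeapTree leaf = ⊤
HeapTree (node l q r) = HeapTree l × HeapTree r × Below l q × Below r q

DecreasingLabeling : Forest ℕ → Set
DecreasingLabeling Q =
  All (λ b → HeapTree (proj₂ b)) Q
  × (labels Q ↭ map suc (upTo (length (labels Q))))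

ValidPair : Forest Zbar → Forest ℕ → Set
ValidPair P Q = Σ (Forest ⊤) λ F →
  IsIndexedForest F × shape P ≡ F × shape Q ≡ F × LBS P × DecreasingLabeling Q

findBlock : {A : Set} → (Block A → Bool) → Forest A → Maybe (Block A)
findBlock p [] = nothing
findBlock p (b ∷ bs) = if p b then just b else findBlock p bs

containsB : {A : Set} → ℤ → Block A → Bool
containsB i (s , t) = does (s ℤ.≤? i) ∧ does (i ℤ.<? s ℤ.+ + size t)

startsAt : {A : Set} → ℤ → Block A → Bool
startsAt x (s , t) = does (s ℤ.≟ x)

endsAt : {A : Set} → ℤ → Block A → Bool
endsAt x b = does (nxt b ℤ.≟ x ℤ.+ ℤ.1ℤ)

removeStart : {A : Set} → ℤ → Forest A → Forest A
removeStart x = filter (λ b → ¬? (proj₁ b ℤ.≟ x))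

dropM : {A : Set} → Maybe (Block A) → Forest A → Forest A
dropM nothing F = F
dropM (just b) F = removeStart (proj₁ b) F

treeOf : {A : Set} → Maybe (Block A) → Tree A
treeOf nothing = leaf
treeOf (just b) = proj₂ b

insertSorted : {A : Set} → Block A → Forest A → Forest A
insertSorted b [] = b ∷ []
insertSorted b (b′ ∷ bs) =
  if does (proj₁ b ℤ.<? proj₁ b′) then b ∷ b′ ∷ bs else b′ ∷ insertSorted b bs

PQForest : Set
PQForest = Forest (Zbar × ℕ)

-- insertion of letter a, with recording label q = |W|
ins : Zbar → ℕ → PQForest → PQForest
ins a q F with findBlock (containsB (val a)) F
... | nothing =
  let i = val a
      L = findBlock (endsAt (i ℤ.- ℤ.1ℤ)) F
      R = findBlock (startsAt (i ℤ.+ ℤ.1ℤ)) F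
  in insertSorted (maybe proj₁ i L , node (treeOf L) (a , q) (treeOf R))
                  (dropM R (dropM L F))
... | just (s , leaf) = F   -- impossible for well-formed forests
... | just (s , node l (aj , qj) r) =
  let t = node l (aj , qj) r in
  if does (aj <Z̄? a)
  then  -- case (ii): max I_j + 2 = s + size t + 1
    (let R = findBlock (startsAt (s ℤ.+ + size t ℤ.+ ℤ.1ℤ)) F
     in insertSorted (s , node t (a , q) (treeOf R))
                     (dropM R (removeStart s F)))
  else  -- case (iii): min I_j - 2 = s - 2
    (let L = findBlock (endsAt (s ℤ.- + 2)) F
     in insertSorted (maybe proj₁ (s ℤ.- ℤ.1ℤ) L , node (treeOf L) (a , q) t)
                     (dropM L (removeStart s F)))

-- F(W) with decorations (P(W)(u) , Q(W)(u)); n = number of letters read so far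
rsAux : PQForest → ℕ → List Zbar → PQForest
rsAux F n [] = F
rsAux F n (a ∷ w) = rsAux (ins a (suc n) F) (suc n) w

RS : List Zbar → PQForest
RS W = rsAux [] 0 W

Pof : List Zbar → Forest Zbar
Pof W = mapForest proj₁ (RS W)

Qof : List Zbar → Forest ℕ
Qof W = mapForest proj₂ (RS W)

-- Write a decorated forest as A ++ [s , l] ++ [s + |l| + 1 , r] ++ C, where the trees l and r (each
-- possibly empty) are separated by the single free position c = s + |l|.  If a letter a fits there,
-- i.e. s ≤ val a < s + |l| + |r| + 1 and a lies between the root letters of l and r, then each of the
-- insertion cases (i)-(iii) glues l and r under a new root labelled a.  Every fresh letter fits somewhere
-- in a forest satisfying the invariant, so insertion preserves it.  Conversely, in a valid pair on n + 1
-- nodes the node with Q-label n + 1 is a root; removing it leaves a valid pair on n nodes in which its letter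
-- fits exactly there.  Hence inserting a letter with recording label n + 1 and removing the root with
-- Q-label n + 1 are mutually inverse, and bijectivity follows by induction on the length of the word.

module Submission where

open import Defs
open import Data.List using (List)
open import Data.Nat using (ℕ)
open import Data.Product using (_×_; Σ)
open import Data.List.Relation.Unary.Unique.Propositional using (Unique)
open import Relation.Binary.PropositionalEquality using (_≡_)

open import Data.Bool using (Bool; true; false; _∧_)
open import Data.Bool.Properties using (∧-zeroʳ)
open import Data.Nat as ℕ using (zero; suc)
import Data.Nat.Properties as ℕ
open import Data.Integer as ℤ using (ℤ; +_; 1ℤ)
import Data.Integer.Properties as ℤ
open import Data.Integer.Solver using (module +-*-Solver)
open import Data.Product using (_,_; proj₁; proj₂; map₂)
open import Data.Product.Properties using (,-injectiveˡ; ,-injectiveʳ)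
open import Data.Sum using (_⊎_; inj₁; inj₂)
open import Data.Unit using (⊤; tt)
open import Data.Empty using (⊥; ⊥-elim)
open import Data.Maybe as Maybe using (Maybe; just; nothing; maybe)
import Data.Maybe.Properties as Maybe
open import Data.List using ([]; _∷_; _++_; _∷ʳ_; map; length; upTo; initLast; _∷ʳ′_)
import Data.List.Properties as List
open import Data.List.Reverse using (Reverse; reverseView; []; _∶_∶ʳ_)
open import Data.List.Relation.Unary.All as All using (All; []; _∷_)
import Data.List.Relation.Unary.All.Properties as All
open import Data.List.Relation.Unary.Any using (Any)
import Data.List.Relation.Unary.Any.Properties as Any
open import Data.List.Relation.Unary.AllPairs as AllPairs using (AllPairs; []; _∷_)
import Data.List.Relation.Unary.AllPairs.Properties as AllPairs
import Data.List.Membership.Propositional.Properties as Membership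
open import Data.List.Relation.Binary.Permutation.Propositional
  using (_↭_; ↭-refl; ↭-reflexive; ↭-sym; ↭-trans; prep; ↭⇒↭ₛ; module PermutationReasoning)
import Data.List.Relation.Binary.Permutation.Propositional.Properties as Perm
import Data.List.Relation.Binary.Permutation.Setoid.Properties as PermSetoid
open import Relation.Binary.PropositionalEquality
  using (refl; sym; trans; cong; cong₂; subst; subst₂; _≢_; setoid; module ≡-Reasoning)
open import Relation.Nullary using (yes; no; does; ¬_; ¬?)
open import Relation.Nullary.Decidable using (dec-true; dec-false)
open import Relation.Binary using (tri<; tri≈; tri>)
open import Function using (_∘_)

open +-*-Solver using (solve; _:+_; _:=_; con)

+-suc-+1 : ∀ s n → s ℤ.+ + suc n ≡ (s ℤ.+ + n) ℤ.+ 1ℤ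
+-suc-+1 s n = trans (cong (λ z → s ℤ.+ z) (ℤ.pos-+ 1 n))
  (solve 2 (λ x y → x :+ (con 1ℤ :+ y) := (x :+ y) :+ con 1ℤ) refl s (+ n))

i-1+1≡i : ∀ i → (i ℤ.- 1ℤ) ℤ.+ 1ℤ ≡ i
i-1+1≡i = solve 1 (λ x → (x :+ con (ℤ.- 1ℤ)) :+ con 1ℤ := x) refl

i+1-1≡i : ∀ i → (i ℤ.+ 1ℤ) ℤ.- 1ℤ ≡ i
i+1-1≡i = solve 1 (λ x → (x :+ con 1ℤ) :+ con (ℤ.- 1ℤ) := x) refl

i+1-2+1≡i : ∀ i → ((i ℤ.+ 1ℤ) ℤ.- + 2) ℤ.+ 1ℤ ≡ i
i+1-2+1≡i = solve 1 (λ x → ((x :+ con 1ℤ) :+ con (ℤ.- + 2)) :+ con 1ℤ := x) refl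

+-+-assoc : ∀ s m n → (s ℤ.+ + m) ℤ.+ + n ≡ s ℤ.+ + (m ℕ.+ n)
+-+-assoc s m n = trans (ℤ.+-assoc s (+ m) (+ n)) (cong (λ z → s ℤ.+ z) (sym (ℤ.pos-+ m n)))

+-suc-+-assoc : ∀ s m n → (s ℤ.+ + suc m) ℤ.+ + n ≡ s ℤ.+ + (m ℕ.+ suc n)
+-suc-+-assoc s m n = trans (+-+-assoc s (suc m) n) (cong (λ k → s ℤ.+ + k) (sym (ℕ.+-suc m n)))

i+m<i+[m+suc-n] : ∀ i m n → i ℤ.+ + m ℤ.< i ℤ.+ + (m ℕ.+ suc n)
i+m<i+[m+suc-n] i m n = ℤ.+-monoʳ-< i (ℤ.+<+ (ℕ.m<m+n m (ℕ.s≤s ℕ.z≤n)))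

i≤i+n : ∀ i n → i ℤ.≤ i ℤ.+ + n
i≤i+n i n = ℤ.i≤i+j i (+ n)

i<i+1 : ∀ i → i ℤ.< i ℤ.+ 1ℤ
i<i+1 i = subst (ℤ._< i ℤ.+ 1ℤ) (ℤ.+-identityʳ i) (ℤ.+-monoʳ-< i (ℤ.+<+ (ℕ.s≤s ℕ.z≤n)))

i-1≤i : ∀ i → i ℤ.- 1ℤ ℤ.≤ i
i-1≤i i = ℤ.<⇒≤ (subst (i ℤ.- 1ℤ ℤ.<_) (i-1+1≡i i) (i<i+1 (i ℤ.- 1ℤ)))

i<j⇒i+1≤j : ∀ {i j} → i ℤ.< j → i ℤ.+ 1ℤ ℤ.≤ j
i<j⇒i+1≤j {i} {j} p = subst (ℤ._≤ j) (ℤ.+-comm 1ℤ i) (ℤ.i<j⇒suc[i]≤j p)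

i<j⇒i≤j-1 : ∀ {i j} → i ℤ.< j → i ℤ.≤ j ℤ.- 1ℤ
i<j⇒i≤j-1 {i} {j} p = ℤ.≮⇒≥ λ j-1<i →
  ℤ.<-irrefl refl (ℤ.<-≤-trans p (subst (ℤ._≤ i) (i-1+1≡i j) (i<j⇒i+1≤j j-1<i)))

-- A node of RS W carries its P-label (a letter) and its Q-label (a stamp).
PQ : Set
PQ = Zbar × ℕ

start : {X : Set} → Block X → ℤ
start = proj₁

start≤nxt : {X : Set} (b : Block X) → start b ℤ.≤ nxt b
start≤nxt (s , t) = i≤i+n s (size t)

_≺_ : {X : Set} → Block X → Block X → Set
b ≺ b′ = nxt b ℤ.< start b′

NonEmptyBlock : {X : Set} → Block X → Set
NonEmptyBlock b = NonEmptyTree (proj₂ b)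

blk : {X : Set} → ℤ → Tree X → Forest X
blk s leaf = []
blk s (node l x r) = (s , node l x r) ∷ []

blk? : {X : Set} → ℤ → Tree X → Maybe (Block X)
blk? s leaf = nothing
blk? s (node l x r) = just (s , node l x r)

All-blk : ∀ {X : Set} {P : Block X → Set} s t → P (s , t) → All P (blk s t)
All-blk s leaf p = []
All-blk s (node _ _ _) p = p ∷ []

All-blk⁻ : ∀ {X : Set} {P : Block X → Set} → (∀ s → P (s , leaf)) → ∀ s t → All P (blk s t) → P (s , t)
All-blk⁻ P-leaf s leaf _ = P-leaf s
All-blk⁻ P-leaf s (node _ _ _) (p ∷ []) = p

AllPairs-blk : ∀ {X : Set} {R : Block X → Block X → Set} s t → AllPairs R (blk s t)
AllPairs-blk s leaf = []
AllPairs-blk s (node _ _ _) = [] ∷ []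

treeOf-blk? : ∀ {X : Set} s (t : Tree X) → treeOf (blk? s t) ≡ t
treeOf-blk? s leaf = refl
treeOf-blk? s (node _ _ _) = refl

start-blk? : ∀ {X : Set} s (t : Tree X) → maybe proj₁ (s ℤ.+ + size t) (blk? s t) ≡ s
start-blk? s leaf = ℤ.+-identityʳ s
start-blk? s (node _ _ _) = refl

module _ {X : Set} where

  containsB-above : ∀ i (b : Block X) → nxt b ℤ.≤ i → containsB i b ≡ false
  containsB-above i (s , t) p =
    trans (cong (does (s ℤ.≤? i) ∧_) (dec-false (i ℤ.<? nxt (s , t)) (λ q → ℤ.<-irrefl refl (ℤ.<-≤-trans q p))))
      (∧-zeroʳ _)

  containsB-below : ∀ i (b : Block X) → i ℤ.< start b → containsB i b ≡ false
  containsB-below i (s , t) p rewrite dec-false (s ℤ.≤? i) (λ q → ℤ.<-irrefl refl (ℤ.<-≤-trans p q)) = refl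

  containsB-inside : ∀ i (b : Block X) → start b ℤ.≤ i → i ℤ.< nxt b → containsB i b ≡ true
  containsB-inside i (s , t) p q rewrite dec-true (s ℤ.≤? i) p | dec-true (i ℤ.<? nxt (s , t)) q = refl

  findBlock-++ : ∀ (p : Block X → Bool) A Y → All (λ b → p b ≡ false) A → findBlock p (A ++ Y) ≡ findBlock p Y
  findBlock-++ p [] Y [] = refl
  findBlock-++ p (b ∷ A) Y (e ∷ es) rewrite e = findBlock-++ p A Y es

  findBlock-none : ∀ (p : Block X → Bool) Y → All (λ b → p b ≡ false) Y → findBlock p Y ≡ nothing
  findBlock-none p [] [] = refl
  findBlock-none p (b ∷ Y) (e ∷ es) rewrite e = findBlock-none p Y es

  findBlock-blk : ∀ (p : Block X → Bool) s t Y → p (s , t) ≡ true → findBlock p Y ≡ nothing →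
                  findBlock p (blk s t ++ Y) ≡ blk? s t
  findBlock-blk p s leaf Y _ none = none
  findBlock-blk p s (node _ _ _) Y hit _ rewrite hit = refl

  removeStart-absent : ∀ x (Y : Forest X) → All (λ b → start b ≢ x) Y → removeStart x Y ≡ Y
  removeStart-absent x Y = List.filter-all (¬? ∘ (ℤ._≟ x) ∘ start)

  removeStart-blk : ∀ x t (Y Z : Forest X) → All (λ b → start b ≢ x) Y → All (λ b → start b ≢ x) Z →
                    removeStart x (Y ++ blk x t ++ Z) ≡ Y ++ Z
  removeStart-blk x t Y Z Y≢x Z≢x =
    trans (List.filter-++ (¬? ∘ (ℤ._≟ x) ∘ start) Y _) (cong₂ _++_ (removeStart-absent x Y Y≢x) (dropped t))
    where
      dropped : ∀ t → removeStart x (blk x t ++ Z) ≡ Z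
      dropped leaf = removeStart-absent x Z Z≢x
      dropped (node _ _ _) =
        trans (List.filter-reject (¬? ∘ (ℤ._≟ x) ∘ start) (λ x≢x → x≢x refl)) (removeStart-absent x Z Z≢x)

  dropM-blk : ∀ x t (Y Z : Forest X) → All (λ b → start b ≢ x) Y → All (λ b → start b ≢ x) Z →
              dropM (blk? x t) (Y ++ blk x t ++ Z) ≡ Y ++ Z
  dropM-blk x leaf Y Z _ _ = refl
  dropM-blk x (node l y r) = removeStart-blk x (node l y r)

  insertSorted-++ : ∀ (b : Block X) A Y → All (λ b′ → start b′ ℤ.≤ start b) A →
                    insertSorted b (A ++ Y) ≡ A ++ insertSorted b Y
  insertSorted-++ b [] Y [] = refl
  insertSorted-++ b (b′ ∷ A) Y (e ∷ es)
    rewrite dec-false (start b ℤ.<? start b′) (λ q → ℤ.<-irrefl refl (ℤ.<-≤-trans q e))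
    = cong (b′ ∷_) (insertSorted-++ b A Y es)

  insertSorted-head : ∀ (b : Block X) Y → All (λ b′ → start b ℤ.< start b′) Y → insertSorted b Y ≡ b ∷ Y
  insertSorted-head b [] _ = refl
  insertSorted-head b (b′ ∷ Y) (e ∷ _) rewrite dec-true (start b ℤ.<? start b′) e = refl

-- Insertion next to a gap

unglued : {X : Set} → Forest X → ℤ → Tree X → Tree X → Forest X → Forest X
unglued A s l r C = A ++ blk s l ++ blk (s ℤ.+ + suc (size l)) r ++ C

glued : {X : Set} → Forest X → ℤ → Tree X → X → Tree X → Forest X → Forest X
glued A s l x r C = A ++ (s , node l x r) ∷ C

module Neighbourhood {X : Set} (A C : Forest X) (s : ℤ) (l r : Tree X) (x : X)
                     (A≺s : All (λ b → nxt b ℤ.< s) A)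
                     (N≺C : All (λ b → nxt (s , node l x r) ℤ.< start b) C) where

  c rs N : ℤ
  c = s ℤ.+ + size l
  rs = s ℤ.+ + suc (size l)
  N = nxt (s , node l x r)

  F : Forest X
  F = unglued A s l r C

  rs≡c+1 : rs ≡ c ℤ.+ 1ℤ
  rs≡c+1 = +-suc-+1 s (size l)

  s≤c : s ℤ.≤ c
  s≤c = i≤i+n s (size l)

  c<rs : c ℤ.< rs
  c<rs = subst (c ℤ.<_) (sym rs≡c+1) (i<i+1 c)

  s<rs : s ℤ.< rs
  s<rs = ℤ.≤-<-trans s≤c c<rs

  nxt-r≡N : nxt (rs , r) ≡ N
  nxt-r≡N = +-suc-+-assoc s (size l) (size r)

  rs≤N : rs ℤ.≤ N
  rs≤N = subst (rs ℤ.≤_) nxt-r≡N (start≤nxt (rs , r))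

  c<N : c ℤ.< N
  c<N = ℤ.<-≤-trans c<rs rs≤N

  s≤N : s ℤ.≤ N
  s≤N = ℤ.≤-trans s≤c (ℤ.<⇒≤ c<N)

  c<i⇒rs≤i : ∀ {i} → c ℤ.< i → rs ℤ.≤ i
  c<i⇒rs≤i p = subst (ℤ._≤ _) (sym rs≡c+1) (i<j⇒i+1≤j p)

  A-all : ∀ {P : Block X → Set} → (∀ b → nxt b ℤ.< s → P b) → All P A
  A-all f = All.map (λ {b} → f b) A≺s

  C-all : ∀ {P : Block X → Set} → (∀ b → N ℤ.< start b → P b) → All P C
  C-all f = All.map (λ {b} → f b) N≺C

  F-all : ∀ {P : Block X → Set} → (∀ b → nxt b ℤ.< s → P b) → P (s , l) → P (rs , r) →
          (∀ b → N ℤ.< start b → P b) → All P F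
  F-all fA pl pr fC = All.++⁺ (A-all fA) (All.++⁺ (All-blk s l pl) (All.++⁺ (All-blk rs r pr) (C-all fC)))

  findContaining-gap : findBlock (containsB c) F ≡ nothing
  findContaining-gap = findBlock-none _ F
    (F-all (λ b p → containsB-above c b (ℤ.<⇒≤ (ℤ.<-≤-trans p s≤c))) (containsB-above c (s , l) ℤ.≤-refl)
           (containsB-below c (rs , r) c<rs) (λ b p → containsB-below c b (ℤ.<-trans c<N p)))

  findContaining-left : ∀ i → s ℤ.≤ i → i ℤ.< c → findBlock (containsB i) F ≡ blk? s l
  findContaining-left i s≤i i<c = trans
    (findBlock-++ _ A _ (A-all (λ b p → containsB-above i b (ℤ.<⇒≤ (ℤ.<-≤-trans p s≤i)))))
    (findBlock-blk _ s l _ (containsB-inside i (s , l) s≤i i<c)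
      (findBlock-none _ (blk rs r ++ C)
        (All.++⁺ (All-blk rs r (containsB-below i (rs , r) (ℤ.<-trans i<c c<rs)))
                 (C-all (λ b p → containsB-below i b (ℤ.<-trans (ℤ.<-trans i<c c<N) p))))))

  findContaining-right : ∀ i → c ℤ.< i → i ℤ.< N → findBlock (containsB i) F ≡ blk? rs r
  findContaining-right i c<i i<N = trans
    (findBlock-++ _ A _ (A-all (λ b p → containsB-above i b (ℤ.<⇒≤ (ℤ.<-≤-trans p (ℤ.<⇒≤ s<i))))))
    (trans (findBlock-++ _ (blk s l) _ (All-blk s l (containsB-above i (s , l) (ℤ.<⇒≤ c<i))))
      (findBlock-blk _ rs r C (containsB-inside i (rs , r) (c<i⇒rs≤i c<i) (subst (i ℤ.<_) (sym nxt-r≡N) i<N))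
        (findBlock-none _ C (C-all (λ b p → containsB-below i b (ℤ.<-trans i<N p))))))
    where s<i = ℤ.≤-<-trans s≤c c<i

  findEndingAt-left : ∀ y → y ℤ.+ 1ℤ ≡ c → findBlock (endsAt y) F ≡ blk? s l
  findEndingAt-left y y+1≡c = trans
    (findBlock-++ _ A _ (A-all (λ b p → ends b (ℤ.<⇒≢ (ℤ.<-≤-trans p s≤c)))))
    (findBlock-blk _ s l _ (dec-true (_ ℤ.≟ _) (sym y+1≡c))
      (findBlock-none _ (blk rs r ++ C)
        (All.++⁺ (All-blk rs r (ends (rs , r) (λ e → ℤ.<⇒≢ c<N (sym (trans (sym nxt-r≡N) e)))))
                 (C-all (λ b p → ends b (λ e → ℤ.<⇒≢ (ℤ.<-trans c<N (ℤ.<-≤-trans p (start≤nxt b)))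
                                                     (sym e)))))))
    where
      ends : ∀ b → nxt b ≢ c → endsAt y b ≡ false
      ends b ≢c = dec-false (_ ℤ.≟ _) (λ e → ≢c (trans e y+1≡c))

  findStartingAt-right : findBlock (startsAt rs) F ≡ blk? rs r
  findStartingAt-right = trans
    (findBlock-++ _ A _ (A-all (λ b p → starts b (ℤ.<⇒≢ (ℤ.<-trans (ℤ.≤-<-trans (start≤nxt b) p) s<rs)))))
    (trans (findBlock-++ _ (blk s l) _ (All-blk s l (starts (s , l) (ℤ.<⇒≢ s<rs))))
      (findBlock-blk _ rs r C (dec-true (rs ℤ.≟ rs) refl)
        (findBlock-none _ C (C-all (λ b p → starts b (λ e → ℤ.<⇒≢ (ℤ.≤-<-trans rs≤N p) (sym e)))))))
    where
      starts : ∀ b → start b ≢ rs → startsAt rs b ≡ false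
      starts (t , _) = dec-false (t ℤ.≟ rs)

  start≢-A : ∀ z → s ℤ.≤ z → All (λ b → start b ≢ z) A
  start≢-A z s≤z = A-all (λ b p → ℤ.<⇒≢ (ℤ.<-≤-trans (ℤ.≤-<-trans (start≤nxt b) p) s≤z))

  start≢-C : ∀ z → z ℤ.≤ N → All (λ b → start b ≢ z) C
  start≢-C z z≤N = C-all (λ b p e → ℤ.<⇒≢ (ℤ.≤-<-trans z≤N p) (sym e))

  start≢s-rC : All (λ b → start b ≢ s) (blk rs r ++ C)
  start≢s-rC = All.++⁺ (All-blk rs r (λ e → ℤ.<⇒≢ s<rs (sym e))) (start≢-C s s≤N)

  removeStart-left : removeStart s F ≡ A ++ blk rs r ++ C
  removeStart-left = removeStart-blk s l A _ (start≢-A s ℤ.≤-refl) start≢s-rC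

  dropM-left : dropM (blk? s l) F ≡ A ++ blk rs r ++ C
  dropM-left = dropM-blk s l A _ (start≢-A s ℤ.≤-refl) start≢s-rC

  dropM-right : dropM (blk? rs r) (A ++ blk rs r ++ C) ≡ A ++ C
  dropM-right = dropM-blk rs r A C (start≢-A rs (ℤ.<⇒≤ s<rs)) (start≢-C rs rs≤N)

  dropM-left-remove-right : dropM (blk? s l) (removeStart rs F) ≡ A ++ C
  dropM-left-remove-right = trans
    (cong (λ Y → dropM (blk? s l) (removeStart rs Y)) (sym (List.++-assoc A (blk s l) (blk rs r ++ C))))
    (trans (cong (dropM (blk? s l))
             (removeStart-blk rs r (A ++ blk s l) C
               (All.++⁺ (start≢-A rs (ℤ.<⇒≤ s<rs)) (All-blk s l (ℤ.<⇒≢ s<rs))) (start≢-C rs rs≤N)))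
      (trans (cong (dropM (blk? s l)) (List.++-assoc A (blk s l) C))
        (dropM-blk s l A C (start≢-A s ℤ.≤-refl) (start≢-C s s≤N))))

  insertSorted-between : ∀ t → insertSorted (s , t) (A ++ C) ≡ A ++ (s , t) ∷ C
  insertSorted-between t = trans
    (insertSorted-++ (s , t) A C (A-all (λ b p → ℤ.<⇒≤ (ℤ.≤-<-trans (start≤nxt b) p))))
    (cong (A ++_) (insertSorted-head (s , t) C (C-all (λ b p → ℤ.≤-<-trans s≤N p))))

<Z̄-asym : ∀ {x y} → x <Z̄ y → ¬ (y <Z̄ x)
<Z̄-asym (inj₁ p) (inj₁ q) = ℤ.<-asym p q
<Z̄-asym (inj₁ p) (inj₂ (e , _)) = ℤ.<-irrefl (sym e) p
<Z̄-asym (inj₂ (e , _)) (inj₁ q) = ℤ.<-irrefl (sym e) q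
<Z̄-asym (inj₂ (_ , p)) (inj₂ (_ , q)) = ℕ.<-asym p q

ins-gap : ∀ a q F → findBlock (containsB (val a)) F ≡ nothing →
  let L = findBlock (endsAt (val a ℤ.- 1ℤ)) F
      R = findBlock (startsAt (val a ℤ.+ 1ℤ)) F
  in ins a q F ≡ insertSorted (maybe proj₁ (val a) L , node (treeOf L) (a , q) (treeOf R)) (dropM R (dropM L F))
ins-gap a q F e rewrite e = refl

ins-above-root : ∀ a q F s l x r → findBlock (containsB (val a)) F ≡ just (s , node l x r) → proj₁ x <Z̄ a →
  let t = node l x r
      R = findBlock (startsAt (s ℤ.+ + size t ℤ.+ 1ℤ)) F
  in ins a q F ≡ insertSorted (s , node t (a , q) (treeOf R)) (dropM R (removeStart s F))
ins-above-root a q F s l x r e x<a rewrite e | dec-true (proj₁ x <Z̄? a) x<a = refl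

ins-below-root : ∀ a q F s l x r → findBlock (containsB (val a)) F ≡ just (s , node l x r) → ¬ (proj₁ x <Z̄ a) →
  let t = node l x r
      L = findBlock (endsAt (s ℤ.- + 2)) F
  in ins a q F ≡ insertSorted (maybe proj₁ (s ℤ.- 1ℤ) L , node (treeOf L) (a , q) t) (dropM L (removeStart s F))
ins-below-root a q F s l x r e x≮a rewrite e | dec-false (proj₁ x <Z̄? a) x≮a = refl

insertSorted-glue : ∀ {X : Set} (x : X) s l rs r d (G H : Forest X) → d ≡ s ℤ.+ + size l → G ≡ H →
  insertSorted (maybe proj₁ d (blk? s l) , node (treeOf (blk? s l)) x (treeOf (blk? rs r))) G
    ≡ insertSorted (s , node l x r) H
insertSorted-glue x s l rs r d G H refl refl rewrite treeOf-blk? s l | treeOf-blk? rs r | start-blk? s l = refl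

-- The letter a can be made the root of a block whose left and right subtrees are the adjacent,
-- possibly empty, blocks l and r of unglued A s l r C.
record Site (A : Forest PQ) (s : ℤ) (l r : Tree PQ) (C : Forest PQ) (a : Zbar) : Set where
  field
    A≺s : All (λ b → nxt b ℤ.< s) A
    end≺C : All (λ b → s ℤ.+ + (size l ℕ.+ suc (size r)) ℤ.< start b) C
    s≤a : s ℤ.≤ val a
    a<end : val a ℤ.< s ℤ.+ + (size l ℕ.+ suc (size r))
    left-ok : LeftOK (mapTree proj₁ l) a
    right-ok : RightOK a (mapTree proj₁ r)

ins-glue-gap : ∀ A s l r C a q → Site A s l r C a → val a ≡ s ℤ.+ + size l →
  ins a q (unglued A s l r C) ≡ glued A s l (a , q) r C
ins-glue-gap A s l r C a q site a≡c =
  trans (ins-gap a q F no-block)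
    (trans (cong₂ reassemble found-left found-right)
      (trans (insertSorted-glue (a , q) s l rs r (val a) _ _ a≡c (trans (cong (dropM (blk? rs r)) dropM-left) dropM-right))
        (insertSorted-between _)))
  where
    open Site site
    open Neighbourhood A C s l r (a , q) A≺s end≺C
    reassemble : Maybe (Block PQ) → Maybe (Block PQ) → Forest PQ
    reassemble L R = insertSorted (maybe proj₁ (val a) L , node (treeOf L) (a , q) (treeOf R)) (dropM R (dropM L F))
    no-block : findBlock (containsB (val a)) F ≡ nothing
    no-block = subst (λ i → findBlock (containsB i) F ≡ nothing) (sym a≡c) findContaining-gap
    found-left : findBlock (endsAt (val a ℤ.- 1ℤ)) F ≡ blk? s l
    found-left = findEndingAt-left (val a ℤ.- 1ℤ) (trans (i-1+1≡i (val a)) a≡c)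
    found-right : findBlock (startsAt (val a ℤ.+ 1ℤ)) F ≡ blk? rs r
    found-right = trans (cong (λ i → findBlock (startsAt i) F) (trans (cong (ℤ._+ 1ℤ) a≡c) (sym rs≡c+1)))
                        findStartingAt-right

ins-glue-left : ∀ A s tl x tr r C a q → Site A s (node tl x tr) r C a → val a ℤ.< s ℤ.+ + size (node tl x tr) →
  ins a q (unglued A s (node tl x tr) r C) ≡ glued A s (node tl x tr) (a , q) r C
ins-glue-left A s tl x tr r C a q site a<c =
  trans (ins-above-root a q F s tl x tr (findContaining-left (val a) s≤a a<c) left-ok)
    (trans (cong reassemble found-right)
      (trans (cong₂ (λ t Y → insertSorted (s , node l (a , q) t) Y) (treeOf-blk? rs r)
                    (trans (cong (dropM (blk? rs r)) removeStart-left) dropM-right))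
        (insertSorted-between _)))
  where
    l = node tl x tr
    open Site site
    open Neighbourhood A C s l r (a , q) A≺s end≺C
    reassemble : Maybe (Block PQ) → Forest PQ
    reassemble R = insertSorted (s , node l (a , q) (treeOf R)) (dropM R (removeStart s F))
    found-right : findBlock (startsAt (c ℤ.+ 1ℤ)) F ≡ blk? rs r
    found-right = trans (cong (λ i → findBlock (startsAt i) F) (sym rs≡c+1)) findStartingAt-right

ins-glue-right : ∀ A s l tl x tr C a q → Site A s l (node tl x tr) C a → s ℤ.+ + size l ℤ.< val a →
  ins a q (unglued A s l (node tl x tr) C) ≡ glued A s l (a , q) (node tl x tr) C
ins-glue-right A s l tl x tr C a q site c<a =
  trans (ins-below-root a q F rs tl x tr (findContaining-right (val a) c<a a<end) (<Z̄-asym right-ok))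
    (trans (cong reassemble found-left)
      (trans (insertSorted-glue (a , q) s l rs r (rs ℤ.- 1ℤ) _ _ rs-1≡c dropM-left-remove-right)
        (insertSorted-between _)))
  where
    r = node tl x tr
    open Site site
    open Neighbourhood A C s l r (a , q) A≺s end≺C
    reassemble : Maybe (Block PQ) → Forest PQ
    reassemble L = insertSorted (maybe proj₁ (rs ℤ.- 1ℤ) L , node (treeOf L) (a , q) r) (dropM L (removeStart rs F))
    found-left : findBlock (endsAt (rs ℤ.- + 2)) F ≡ blk? s l
    found-left = findEndingAt-left (rs ℤ.- + 2) (trans (cong (λ i → (i ℤ.- + 2) ℤ.+ 1ℤ) rs≡c+1) (i+1-2+1≡i c))
    rs-1≡c : rs ℤ.- 1ℤ ≡ c
    rs-1≡c = trans (cong (ℤ._- 1ℤ) rs≡c+1) (i+1-1≡i c)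

-- The insertion cases (i), (ii) and (iii) are val a = c, val a < c and val a > c respectively,
-- where c = s + size l is the canonical label of the gap between l and r.
ins-glue : ∀ A s l r C a q → Site A s l r C a → ins a q (unglued A s l r C) ≡ glued A s l (a , q) r C
ins-glue A s l r C a q site with ℤ.<-cmp (val a) (s ℤ.+ + size l)
... | tri≈ _ a≡c _ = ins-glue-gap A s l r C a q site a≡c
ins-glue A s leaf r C a q site | tri< a<s+0 _ _ =
  ⊥-elim (ℤ.<-irrefl refl (ℤ.<-≤-trans a<s+0 (subst (ℤ._≤ val a) (sym (ℤ.+-identityʳ s)) (Site.s≤a site))))
ins-glue A s (node tl x tr) r C a q site | tri< a<c _ _ = ins-glue-left A s tl x tr r C a q site a<c
ins-glue A s l leaf C a q site | tri> _ _ c<a =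
  ⊥-elim (ℤ.<-irrefl refl (ℤ.<-≤-trans a<end (subst (ℤ._≤ val a) rs≡N (c<i⇒rs≤i c<a))))
  where
    open Site site
    open Neighbourhood A C s l leaf (a , q) A≺s end≺C
    rs≡N : rs ≡ N
    rs≡N = trans (sym (ℤ.+-identityʳ rs)) nxt-r≡N
ins-glue A s l (node tl x tr) C a q site | tri> _ _ c<a = ins-glue-right A s l tl x tr C a q site c<a

AllPairs-++⁻ : ∀ {X : Set} {R : X → X → Set} (xs : List X) {ys : List X} → AllPairs R (xs ++ ys) →
  AllPairs R xs × AllPairs R ys × All (λ x → All (R x) ys) xs
AllPairs-++⁻ [] p = [] , p , []
AllPairs-++⁻ (x ∷ xs) (h ∷ p) =
  let (pxs , pys , cross) = AllPairs-++⁻ xs p in (All.++⁻ˡ xs h ∷ pxs) , pys , (All.++⁻ʳ xs h ∷ cross)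

Unique-resp-↭ : ∀ {X : Set} {xs ys : List X} → xs ↭ ys → Unique xs → Unique ys
Unique-resp-↭ {X} p = PermSetoid.Unique-resp-↭ (setoid X) (↭⇒↭ₛ p)

Unique-∷ʳ⁻ : ∀ {X : Set} (xs : List X) x → Unique (xs ∷ʳ x) → Unique xs × All (x ≢_) xs
Unique-∷ʳ⁻ xs x u =
  let (uxs , _ , cross) = AllPairs-++⁻ xs u in uxs , All.map (λ { (x′≢x ∷ []) → λ e → x′≢x (sym e) }) cross

length-∷ʳ : ∀ {X : Set} (xs : List X) x → length (xs ∷ʳ x) ≡ suc (length xs)
length-∷ʳ xs x = trans (List.length-++ xs) (ℕ.+-comm (length xs) 1)

upTo-suc-↭ : ∀ n → suc n ∷ map suc (upTo n) ↭ map suc (upTo (suc n))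
upTo-suc-↭ n = ↭-trans (Perm.∷↭∷ʳ (suc n) (map suc (upTo n)))
  (↭-reflexive (trans (sym (List.map-++ suc (upTo n) (n ∷ []))) (cong (map suc) (List.upTo-∷ʳ n))))

module _ {X : Set} where

  labels-++ : ∀ (F G : Forest X) → labels (F ++ G) ≡ labels F ++ labels G
  labels-++ = List.concatMap-++ (λ b → inorder (proj₂ b))

  labels-blk-++ : ∀ s (t : Tree X) G → labels (blk s t ++ G) ≡ inorder t ++ labels G
  labels-blk-++ s leaf G = refl
  labels-blk-++ s (node _ _ _) G = refl

  All-labels⁻ : ∀ {P : X → Set} (F : Forest X) → All P (labels F) → All (λ b → All P (inorder (proj₂ b))) F
  All-labels⁻ F h = All.map⁻ (All.concat⁻ h)

  labels-unglued : ∀ A s l r C → labels (unglued A s l r C) ≡ labels A ++ inorder l ++ inorder r ++ labels C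
  labels-unglued A s l r C = trans (labels-++ A _)
    (cong (labels A ++_) (trans (labels-blk-++ s l _) (cong (inorder l ++_) (labels-blk-++ _ r C))))

  labels-glued-↭ : ∀ A s l x r C → labels (glued A s l x r C) ↭ x ∷ labels (unglued A s l r C)
  labels-glued-↭ A s l x r C = begin
    labels (A ++ (s , node l x r) ∷ C)                      ≡⟨ labels-++ A _ ⟩
    labels A ++ (inorder l ++ x ∷ inorder r) ++ labels C   ≡⟨ cong (labels A ++_) (List.++-assoc (inorder l) _ _) ⟩
    labels A ++ inorder l ++ x ∷ inorder r ++ labels C     ↭⟨ Perm.++⁺ˡ (labels A) (Perm.shift x (inorder l) _) ⟩
    labels A ++ x ∷ inorder l ++ inorder r ++ labels C     ↭⟨ Perm.shift x (labels A) _ ⟩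
    x ∷ labels A ++ inorder l ++ inorder r ++ labels C     ≡⟨ cong (x ∷_) (sym (labels-unglued A s l r C)) ⟩
    x ∷ labels (unglued A s l r C)                          ∎
    where open PermutationReasoning

  All-glued⁻ : ∀ {P : Block X → Set} A s l x r C → All P (glued A s l x r C) →
    All P A × P (s , node l x r) × All P C
  All-glued⁻ A s l x r C h = let (hA , hbC) = All.++⁻ A h in hA , All.head hbC , All.tail hbC

  All-unglued⁻ : ∀ {P : Block X → Set} A s l r C → All P (unglued A s l r C) →
    All P A × All P (blk s l) × All P (blk (s ℤ.+ + suc (size l)) r) × All P C
  All-unglued⁻ A s l r C h =
    let (hA , hlrC) = All.++⁻ A h
        (hl , hrC) = All.++⁻ (blk s l) hlrC
        (hr , hC) = All.++⁻ (blk _ r) hrC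
    in hA , hl , hr , hC

  All-unglued⁺ : ∀ {P : Block X → Set} A s l r C → All P A → All P (blk s l) →
    All P (blk (s ℤ.+ + suc (size l)) r) → All P C → All P (unglued A s l r C)
  All-unglued⁺ A s l r C hA hl hr hC = All.++⁺ hA (All.++⁺ hl (All.++⁺ hr hC))

  separated-glue : ∀ A s l x r C →
    All (λ b → nxt b ℤ.< s) A → All (λ b → nxt (s , node l x r) ℤ.< start b) C →
    AllPairs (_≺_ {X}) (unglued A s l r C) → AllPairs (_≺_ {X}) (glued A s l x r C)
  separated-glue A s l x r C A≺s N≺C sep =
    let (sepA , sep-lrC , A≺lrC) = AllPairs-++⁻ A sep
        (_ , sep-rC , _) = AllPairs-++⁻ (blk s l) sep-lrC
        (_ , sepC , _) = AllPairs-++⁻ (blk _ r) sep-rC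
    in AllPairs.++⁺ sepA (N≺C ∷ sepC)
         (All.zipWith (λ (p , q) → p ∷ All.++⁻ʳ (blk _ r) (All.++⁻ʳ (blk s l) q)) (A≺s , A≺lrC))

  separated-unglue : ∀ A s l x r C → AllPairs (_≺_ {X}) (glued A s l x r C) →
    All (λ b → nxt b ℤ.< s) A × All (λ b → nxt (s , node l x r) ℤ.< start b) C
    × AllPairs (_≺_ {X}) (unglued A s l r C)
  separated-unglue A s l x r C sep with AllPairs-++⁻ A sep
  ... | sepA , (N≺C ∷ sepC) , A≺glued = A≺s , N≺C , AllPairs.++⁺ sepA sep-lrC A≺lrC
    where
      A≺s : All (λ b → nxt b ℤ.< s) A
      A≺s = All.map All.head A≺glued
      open Neighbourhood A C s l r x A≺s N≺C
      sep-lrC : AllPairs (_≺_ {X}) (blk s l ++ blk rs r ++ C)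
      sep-lrC = AllPairs.++⁺ (AllPairs-blk s l)
        (AllPairs.++⁺ (AllPairs-blk rs r) sepC (All-blk rs r (All.map (subst (ℤ._< _) (sym nxt-r≡N)) N≺C)))
        (All-blk s l (All.++⁺ (All-blk rs r c<rs) (All.map (ℤ.<-trans c<N) N≺C)))
      A≺lrC : All (λ b → All (b ≺_) (blk s l ++ blk rs r ++ C)) A
      A≺lrC = All.zipWith
        (λ (p , q) → All.++⁺ (All-blk s l p) (All.++⁺ (All-blk rs r (ℤ.<-trans p s<rs)) (All.tail q)))
        (A≺s , A≺glued)

-- The invariant

SearchTree : ℤ → Tree PQ → Set
SearchTree s leaf = ⊤
SearchTree s (node l (a , _) r) = SearchTree s l × SearchTree (s ℤ.+ + suc (size l)) r
  × LeftOK (mapTree proj₁ l) a × RightOK a (mapTree proj₁ r)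
  × (s ℤ.≤ val a) × (val a ℤ.< s ℤ.+ + (size l ℕ.+ suc (size r)))

HeapOrdered : Tree PQ → Set
HeapOrdered leaf = ⊤
HeapOrdered (node l (_ , q) r) =
  HeapOrdered l × HeapOrdered r × Below (mapTree proj₂ l) q × Below (mapTree proj₂ r) q

letters : Forest PQ → List Zbar
letters F = map proj₁ (labels F)

stamps : Forest PQ → List ℕ
stamps F = map proj₂ (labels F)

-- Separation is required of all pairs of blocks, not only of consecutive ones as in Separated.
record Valid (n : ℕ) (F : Forest PQ) : Set where
  field
    nonEmpty : All NonEmptyBlock F
    separated : AllPairs _≺_ F
    search : All (λ b → SearchTree (start b) (proj₂ b)) F
    letters-unique : Unique (letters F)
    heap : All (λ b → HeapOrdered (proj₂ b)) F
    stamps-perm : stamps F ↭ map suc (upTo n)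
open Valid

valid-[] : Valid 0 []
valid-[] = record { nonEmpty = [] ; separated = [] ; search = [] ; letters-unique = [] ; heap = [] ; stamps-perm = ↭-refl }

stamps-≤ : ∀ {n F} → Valid n F → All (λ y → proj₂ y ℕ.≤ n) (labels F)
stamps-≤ {n} V = All.map⁻ (Perm.All-resp-↭ (↭-sym (stamps-perm V)) (All.map⁺ (All.all-upTo n)))

length-labels : ∀ {n F} → Valid n F → length (labels F) ≡ n
length-labels {n} {F} V = begin
  length (labels F)          ≡⟨ sym (List.length-map proj₂ (labels F)) ⟩
  length (stamps F)          ≡⟨ Perm.↭-length (stamps-perm V) ⟩
  length (map suc (upTo n))  ≡⟨ List.length-map suc (upTo n) ⟩
  length (upTo n)            ≡⟨ List.length-upTo n ⟩
  n                          ∎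
  where open ≡-Reasoning

Below-of-All : ∀ (t : Tree PQ) q → All (λ y → proj₂ y ℕ.< q) (inorder t) → Below (mapTree proj₂ t) q
Below-of-All leaf q _ = tt
Below-of-All (node l _ r) q h = All.head (All.++⁻ʳ (inorder l) h)

NonEmpty-blk : ∀ {X : Set} s (t : Tree X) → All NonEmptyBlock (blk s t)
NonEmpty-blk s leaf = []
NonEmpty-blk s (node _ _ _) = tt ∷ []

-- The new root gets the largest stamp, so the heap condition holds for it.
valid-glue : ∀ {n A s l r C a} → Valid n (unglued A s l r C) → Site A s l r C a →
  All (a ≢_) (letters (unglued A s l r C)) → Valid (suc n) (glued A s l (a , suc n) r C)
valid-glue {n} {A} {s} {l} {r} {C} {a} V site fresh = record
  { nonEmpty = let (neA , _ , _ , neC) = All-unglued⁻ A s l r C (nonEmpty V) in All.++⁺ neA (tt ∷ neC)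
  ; separated = separated-glue A s l (a , suc n) r C A≺s end≺C (separated V)
  ; search = let (sA , sl , sr , sC) = All-unglued⁻ A s l r C (search V) in
      All.++⁺ sA ((All-blk⁻ _ s l sl , All-blk⁻ _ _ r sr , left-ok , right-ok , s≤a , a<end) ∷ sC)
  ; letters-unique = Unique-resp-↭ (↭-sym (Perm.map⁺ proj₁ (labels-glued-↭ A s l (a , suc n) r C)))
                                   (fresh ∷ letters-unique V)
  ; heap = let (hA , hl , hr , hC) = All-unglued⁻ A s l r C (heap V)
               (_ , <l , <r , _) = All-unglued⁻ A s l r C (All-labels⁻ _ (All.map ℕ.s≤s (stamps-≤ V)))
           in All.++⁺ hA ((All-blk⁻ _ s l hl , All-blk⁻ _ _ r hr ,
                           Below-of-All l (suc n) (All-blk⁻ (λ _ → []) s l <l) ,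
                           Below-of-All r (suc n) (All-blk⁻ (λ _ → []) _ r <r)) ∷ hC)
  ; stamps-perm = ↭-trans (Perm.map⁺ proj₂ (labels-glued-↭ A s l (a , suc n) r C))
                          (↭-trans (prep (suc n) (stamps-perm V)) (upTo-suc-↭ n))
  }
  where open Site site

valid-unglue : ∀ {m A s l r C a} → Valid (suc m) (glued A s l (a , suc m) r C) →
  Valid m (unglued A s l r C) × Site A s l r C a
valid-unglue {m} {A} {s} {l} {r} {C} {a} V
  with separated-unglue A s l (a , suc m) r C (separated V)
     | All-glued⁻ A s l (a , suc m) r C (nonEmpty V)
     | All-glued⁻ A s l (a , suc m) r C (search V)
     | All-glued⁻ A s l (a , suc m) r C (heap V)
... | A≺s , end≺C , sep | neA , _ , neC | sA , (sl , sr , left-ok , right-ok , s≤a , a<end) , sC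
    | hA , (hl , hr , _ , _) , hC =
  record
    { nonEmpty = All-unglued⁺ A s l r C neA (NonEmpty-blk s l) (NonEmpty-blk _ r) neC
    ; separated = sep
    ; search = All-unglued⁺ A s l r C sA (All-blk s l sl) (All-blk _ r sr) sC
    ; letters-unique = AllPairs.tail (Unique-resp-↭ (Perm.map⁺ proj₁ labels-↭) (letters-unique V))
    ; heap = All-unglued⁺ A s l r C hA (All-blk s l hl) (All-blk _ r hr) hC
    ; stamps-perm = Perm.drop-∷ (↭-trans (↭-sym (Perm.map⁺ proj₂ labels-↭))
                                         (↭-trans (stamps-perm V) (↭-sym (upTo-suc-↭ m))))
    } ,
  record { A≺s = A≺s ; end≺C = end≺C ; s≤a = s≤a ; a<end = a<end ; left-ok = left-ok ; right-ok = right-ok }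
  where labels-↭ = labels-glued-↭ A s l (a , suc m) r C

-- Locating the insertion site

<Z̄-trichotomy : ∀ x y → x <Z̄ y ⊎ x ≡ y ⊎ y <Z̄ x
<Z̄-trichotomy ⟨ i , j ⟩ ⟨ i′ , j′ ⟩ with ℤ.<-cmp i i′
... | tri< i<i′ _ _ = inj₁ (inj₁ i<i′)
... | tri> _ _ i′<i = inj₂ (inj₂ (inj₁ i′<i))
... | tri≈ _ refl _ with ℕ.<-cmp j j′
...   | tri< j<j′ _ _ = inj₁ (inj₂ (refl , j<j′))
...   | tri≈ _ refl _ = inj₂ (inj₁ refl)
...   | tri> _ _ j′<j = inj₂ (inj₂ (inj₂ (refl , j′<j)))

module _ {X : Set} where

  locate : ∀ i (F : Forest X) → AllPairs _≺_ F →
    (Σ (Forest X) λ A → Σ (Block X) λ b → Σ (Forest X) λ C →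
       F ≡ A ++ b ∷ C × start b ℤ.≤ i × i ℤ.< nxt b)
    ⊎ (Σ (Forest X) λ A → Σ (Forest X) λ B →
       F ≡ A ++ B × All (λ b → nxt b ℤ.≤ i) A × All (λ b → i ℤ.< start b) B)
  locate i [] _ = inj₂ ([] , [] , refl , [] , [])
  locate i (b ∷ F) (b≺F ∷ sep) with i ℤ.<? start b
  ... | yes i<b = inj₂ ([] , b ∷ F , refl , [] , i<b ∷ All.map (ℤ.<-trans (ℤ.<-≤-trans i<b (start≤nxt b))) b≺F)
  ... | no i≮b with i ℤ.<? nxt b
  ...   | yes i<end = inj₁ ([] , b , F , refl , ℤ.≮⇒≥ i≮b , i<end)
  ...   | no i≮end with locate i F sep
  ...     | inj₁ (A , b′ , C , e , p , q) = inj₁ (b ∷ A , b′ , C , cong (b ∷_) e , p , q)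
  ...     | inj₂ (A , B , e , p , q) = inj₂ (b ∷ A , B , cong (b ∷_) e , ℤ.≮⇒≥ i≮end ∷ p , q)

  blk-start : ∀ (b : Block X) → NonEmptyBlock b → blk (start b) (proj₂ b) ≡ b ∷ []
  blk-start (s , node _ _ _) _ = refl

  lastBlockEndingAt : ∀ c (A₀ : Forest X) →
    AllPairs _≺_ A₀ → All NonEmptyBlock A₀ → All (λ b → nxt b ℤ.≤ c) A₀ →
    Σ (Forest X) λ A → Σ ℤ λ s → Σ (Tree X) λ l →
      A₀ ≡ A ++ blk s l × s ℤ.+ + size l ≡ c × All (λ b → nxt b ℤ.< s) A
  lastBlockEndingAt c A₀ sep ne end≤c with initLast A₀
  ... | [] = [] , c , leaf , refl , ℤ.+-identityʳ c , []
  ... | A ∷ʳ′ b with AllPairs-++⁻ A sep | All.∷ʳ⁻ ne | All.∷ʳ⁻ end≤c | nxt b ℤ.≟ c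
  ...   | _ , _ , A≺[b] | _ , ne-b | _ , _ | yes b-end≡c =
    A , start b , proj₂ b , cong (A ++_) (sym (blk-start b ne-b)) , b-end≡c , All.map All.head A≺[b]
  ...   | _ , _ , A≺[b] | _ , _ | _ , b-end≤c | no b-end≢c =
    A ∷ʳ b , c , leaf , sym (List.++-identityʳ _) , ℤ.+-identityʳ c ,
    All.∷ʳ⁺ (All.map (λ p → ℤ.<-≤-trans (All.head p) (ℤ.≤-trans (start≤nxt b) b-end≤c)) A≺[b])
            (ℤ.≤∧≢⇒< b-end≤c b-end≢c)

  firstBlockStartingAt : ∀ c (B₀ : Forest X) →
    All NonEmptyBlock B₀ → All (λ b → c ℤ.< start b) B₀ → AllPairs _≺_ B₀ →
    Σ (Tree X) λ r → Σ (Forest X) λ C →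
      B₀ ≡ blk (c ℤ.+ 1ℤ) r ++ C × All (λ b → nxt (c ℤ.+ 1ℤ , r) ℤ.< start b) C
  firstBlockStartingAt c [] _ _ _ = leaf , [] , refl , []
  firstBlockStartingAt c ((s , t) ∷ B) (ne-b ∷ _) (c<s ∷ _) (b≺B ∷ _) with s ℤ.≟ c ℤ.+ 1ℤ
  ... | yes refl = t , B , sym (cong (_++ B) (blk-start (s , t) ne-b)) , b≺B
  ... | no s≢c+1 = leaf , (s , t) ∷ B , refl ,
    subst (ℤ._< s) (sym (ℤ.+-identityʳ _)) c+1<s ∷
    All.map (ℤ.<-trans (subst (ℤ._< nxt (s , t)) (sym (ℤ.+-identityʳ _)) (ℤ.<-≤-trans c+1<s (start≤nxt (s , t)))))
            b≺B
    where c+1<s = ℤ.≤∧≢⇒< (i<j⇒i+1≤j c<s) (λ e → s≢c+1 (sym e))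

LeftOK-below : ∀ s l a → SearchTree s l → s ℤ.+ + size l ℤ.≤ val a → LeftOK (mapTree proj₁ l) a
LeftOK-below s leaf a _ _ = tt
LeftOK-below s (node _ _ _) a (_ , _ , _ , _ , _ , root<end) end≤a = inj₁ (ℤ.<-≤-trans root<end end≤a)

RightOK-above : ∀ s r a → SearchTree s r → val a ℤ.< s → RightOK a (mapTree proj₁ r)
RightOK-above s leaf a _ _ = tt
RightOK-above s (node _ _ _) a (_ , _ , _ , _ , s≤root , _) a<s = inj₁ (ℤ.<-≤-trans a<s s≤root)

record SiteIn (F : Forest PQ) (a : Zbar) : Set where
  field
    A C : Forest PQ
    s : ℤ
    l r : Tree PQ
    F≡ : F ≡ unglued A s l r C
    site : Site A s l r C a

site-in-gap : ∀ {n} a A₀ B₀ → Valid n (A₀ ++ B₀) →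
  All (λ b → nxt b ℤ.≤ val a) A₀ → All (λ b → val a ℤ.< start b) B₀ →
  SiteIn (A₀ ++ B₀) a
site-in-gap a A₀ B₀ V A₀≤a a<B₀
  with AllPairs-++⁻ A₀ (separated V) | All.++⁻ A₀ (nonEmpty V) | All.++⁻ A₀ (search V)
... | sepA₀ , sepB₀ , _ | neA₀ , neB₀ | sA₀ , sB₀
  with lastBlockEndingAt (val a) A₀ sepA₀ neA₀ A₀≤a | firstBlockStartingAt (val a) B₀ neB₀ a<B₀ sepB₀
... | A , s , l , refl , s+l≡a , A≺s | r , C , refl , r≺C = record
  { A = A ; C = C ; s = s ; l = l ; r = r
  ; F≡ = trans (List.++-assoc A (blk s l) _) (cong (λ z → A ++ blk s l ++ blk z r ++ C) (sym rs≡a+1))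
  ; site = record
    { A≺s = A≺s
    ; end≺C = subst (λ e → All (λ b → e ℤ.< start b) C) end≡ r≺C
    ; s≤a = subst (s ℤ.≤_) s+l≡a (i≤i+n s (size l))
    ; a<end = subst (val a ℤ.<_) end≡ (ℤ.<-≤-trans (i<i+1 (val a)) (i≤i+n _ (size r)))
    ; left-ok = LeftOK-below s l a (All-blk⁻ _ s l (All.++⁻ʳ A sA₀)) (ℤ.≤-reflexive s+l≡a)
    ; right-ok = RightOK-above _ r a (All-blk⁻ _ _ r (All.++⁻ˡ (blk _ r) sB₀)) (i<i+1 (val a))
    }
  }
  where
    rs≡a+1 : s ℤ.+ + suc (size l) ≡ val a ℤ.+ 1ℤ
    rs≡a+1 = trans (+-suc-+1 s (size l)) (cong (ℤ._+ 1ℤ) s+l≡a)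
    end≡ : (val a ℤ.+ 1ℤ) ℤ.+ + size r ≡ s ℤ.+ + (size l ℕ.+ suc (size r))
    end≡ = trans (cong (ℤ._+ + size r) (sym rs≡a+1)) (+-suc-+-assoc s (size l) (size r))

site-above-root : ∀ {n} A sb tl x tr C′ a → Valid n (A ++ (sb , node tl x tr) ∷ C′) →
  sb ℤ.≤ val a → val a ℤ.< nxt (sb , node tl x tr) → LeftOK (mapTree proj₁ (node tl x tr)) a →
  SiteIn (A ++ (sb , node tl x tr) ∷ C′) a
site-above-root A sb tl x tr C′ a V sb≤a a<end t<a
  with AllPairs-++⁻ A (separated V) | All.++⁻ A (nonEmpty V) | All.++⁻ A (search V)
... | _ , (b≺C′ ∷ sepC′) , A≺bC′ | _ , (_ ∷ neC′) | _ , (_ ∷ sC′)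
  with firstBlockStartingAt (nxt (sb , node tl x tr)) C′ neC′ b≺C′ sepC′
... | r , C , refl , r≺C = record
  { A = A ; C = C ; s = sb ; l = t ; r = r
  ; F≡ = cong (λ z → A ++ (sb , t) ∷ blk z r ++ C) (sym (+-suc-+1 sb (size t)))
  ; site = record
    { A≺s = All.map All.head A≺bC′
    ; end≺C = subst (λ e → All (λ b → e ℤ.< start b) C) end≡ r≺C
    ; s≤a = sb≤a
    ; a<end = ℤ.<-trans a<end (i+m<i+[m+suc-n] sb (size t) (size r))
    ; left-ok = t<a
    ; right-ok = RightOK-above _ r a (All-blk⁻ _ _ r (All.++⁻ˡ (blk _ r) sC′)) (ℤ.<-trans a<end (i<i+1 _))
    }
  }
  where
    t = node tl x tr
    end≡ : (nxt (sb , t) ℤ.+ 1ℤ) ℤ.+ + size r ≡ sb ℤ.+ + (size t ℕ.+ suc (size r))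
    end≡ = trans (cong (ℤ._+ + size r) (sym (+-suc-+1 sb (size t)))) (+-suc-+-assoc sb (size t) (size r))

site-below-root : ∀ {n} A sb tl x tr C′ a → Valid n (A ++ (sb , node tl x tr) ∷ C′) →
  sb ℤ.≤ val a → val a ℤ.< nxt (sb , node tl x tr) → RightOK a (mapTree proj₁ (node tl x tr)) →
  SiteIn (A ++ (sb , node tl x tr) ∷ C′) a
site-below-root A sb tl x tr C′ a V sb≤a a<end a<t
  with AllPairs-++⁻ A (separated V) | All.++⁻ A (nonEmpty V) | All.++⁻ A (search V)
... | sepA , (b≺C′ ∷ _) , A≺bC′ | neA , _ | sA , _
  with lastBlockEndingAt (sb ℤ.- 1ℤ) A sepA neA (All.map (λ p → i<j⇒i≤j-1 (All.head p)) A≺bC′)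
... | A′ , s , l , refl , s+l≡sb-1 , A′≺s = record
  { A = A′ ; C = C′ ; s = s ; l = l ; r = t
  ; F≡ = trans (List.++-assoc A′ (blk s l) _) (cong (λ z → A′ ++ blk s l ++ (z , t) ∷ C′) (sym rs≡sb))
  ; site = record
    { A≺s = A′≺s
    ; end≺C = subst (λ e → All (λ b → e ℤ.< start b) C′) end≡ b≺C′
    ; s≤a = ℤ.≤-trans (i≤i+n s (size l)) l-end≤a
    ; a<end = subst (val a ℤ.<_) end≡ a<end
    ; left-ok = LeftOK-below s l a (All-blk⁻ _ s l (All.++⁻ʳ A′ sA)) l-end≤a
    ; right-ok = a<t
    }
  }
  where
    t = node tl x tr
    rs≡sb : s ℤ.+ + suc (size l) ≡ sb
    rs≡sb = trans (+-suc-+1 s (size l)) (trans (cong (ℤ._+ 1ℤ) s+l≡sb-1) (i-1+1≡i sb))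
    end≡ : sb ℤ.+ + size t ≡ s ℤ.+ + (size l ℕ.+ suc (size t))
    end≡ = trans (cong (ℤ._+ + size t) (sym rs≡sb)) (+-suc-+-assoc s (size l) (size t))
    l-end≤a : s ℤ.+ + size l ℤ.≤ val a
    l-end≤a = ℤ.≤-trans (ℤ.≤-reflexive s+l≡sb-1) (ℤ.≤-trans (i-1≤i sb) sb≤a)

site-of : ∀ {n F} a → Valid n F → All (a ≢_) (letters F) → SiteIn F a
site-of {F = F} a V fresh with locate (val a) F (separated V)
... | inj₂ (A₀ , B₀ , refl , A₀≤a , a<B₀) = site-in-gap a A₀ B₀ V A₀≤a a<B₀
... | inj₁ (A , (sb , leaf) , C′ , refl , _ , _) = ⊥-elim (All.head (proj₂ (All.++⁻ A (nonEmpty V))))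
... | inj₁ (A , (sb , node tl (aj , qj) tr) , C′ , refl , sb≤a , a<end) with <Z̄-trichotomy aj a
...   | inj₁ aj<a = site-above-root A sb tl (aj , qj) tr C′ a V sb≤a a<end aj<a
...   | inj₂ (inj₂ a<aj) = site-below-root A sb tl (aj , qj) tr C′ a V sb≤a a<end a<aj
...   | inj₂ (inj₁ refl) = ⊥-elim (a≢root refl)
  where
    a≢root : a ≢ aj
    a≢root = All.head (All.++⁻ʳ (inorder tl) (All.head (All.++⁻ʳ A (All-labels⁻ _ (All.map⁻ fresh)))))

-- Undoing an insertion

-- The root stamped q is split off, returning its letter; on a valid forest whose largest stamp is q
-- this inverts ins a q.
removeRoot : ℕ → Forest PQ → Maybe (Zbar × Forest PQ)
removeRoot q [] = nothing
removeRoot q ((s , leaf) ∷ F) = Maybe.map (map₂ ((s , leaf) ∷_)) (removeRoot q F)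
removeRoot q ((s , node l (a , q′) r) ∷ F) with q ℕ.≟ q′
... | yes _ = just (a , unglued [] s l r F)
... | no _ = Maybe.map (map₂ ((s , node l (a , q′) r) ∷_)) (removeRoot q F)

removeRoot-glued : ∀ q A s l a r C → All (λ b → Below (mapTree proj₂ (proj₂ b)) q) A →
  removeRoot q (glued A s l (a , q) r C) ≡ just (a , unglued A s l r C)
removeRoot-glued q [] s l a r C [] with q ℕ.≟ q
... | yes _ = refl
... | no q≢q = ⊥-elim (q≢q refl)
removeRoot-glued q ((s′ , leaf) ∷ A) s l a r C (_ ∷ A<q) rewrite removeRoot-glued q A s l a r C A<q = refl
removeRoot-glued q ((s′ , node l′ (a′ , q′) r′) ∷ A) s l a r C (q′<q ∷ A<q) with q ℕ.≟ q′
... | yes q≡q′ = ⊥-elim (ℕ.<-irrefl (sym q≡q′) q′<q)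
... | no _ rewrite removeRoot-glued q A s l a r C A<q = refl

ins-step : ∀ {n F} a → Valid n F → All (a ≢_) (letters F) →
  Valid (suc n) (ins a (suc n) F) × letters (ins a (suc n) F) ↭ a ∷ letters F
  × removeRoot (suc n) (ins a (suc n) F) ≡ just (a , F)
ins-step {n} a V fresh with site-of a V fresh
... | record { A = A ; C = C ; s = s ; l = l ; r = r ; F≡ = refl ; site = site } =
  subst (Valid (suc n)) (sym glue) (valid-glue V site fresh) ,
  subst (λ G → letters G ↭ a ∷ letters (unglued A s l r C)) (sym glue)
        (Perm.map⁺ proj₁ (labels-glued-↭ A s l (a , suc n) r C)) ,
  trans (cong (removeRoot (suc n)) glue) (removeRoot-glued (suc n) A s l a r C A<suc-n)
  where
    glue = ins-glue A s l r C a (suc n) site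
    A<suc-n : All (λ b → Below (mapTree proj₂ (proj₂ b)) (suc n)) A
    A<suc-n = All.map (λ {b} → Below-of-All (proj₂ b) (suc n))
      (proj₁ (All-unglued⁻ A s l r C (All-labels⁻ _ (All.map ℕ.s≤s (stamps-≤ V)))))

rsAux-∷ʳ : ∀ F n V a → rsAux F n (V ∷ʳ a) ≡ ins a (suc (n ℕ.+ length V)) (rsAux F n V)
rsAux-∷ʳ F n [] a rewrite ℕ.+-identityʳ n = refl
rsAux-∷ʳ F n (b ∷ V) a rewrite ℕ.+-suc n (length V) = rsAux-∷ʳ (ins b (suc n) F) (suc n) V a

RS-∷ʳ : ∀ V a → RS (V ∷ʳ a) ≡ ins a (suc (length V)) (RS V)
RS-∷ʳ = rsAux-∷ʳ [] 0

RS-valid : ∀ W → Unique W → Valid (length W) (RS W) × letters (RS W) ↭ W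
RS-valid W = go (reverseView W)
  where
    go : ∀ {W} → Reverse W → Unique W → Valid (length W) (RS W) × letters (RS W) ↭ W
    go [] _ = valid-[] , ↭-refl
    go (V ∶ rV ∶ʳ a) u =
      let (uV , a∉V) = Unique-∷ʳ⁻ V a u
          (V-valid , V-perm) = go rV uV
          (valid , perm , _) = ins-step a V-valid (Perm.All-resp-↭ (↭-sym V-perm) a∉V)
      in subst₂ Valid (sym (length-∷ʳ V a)) (sym (RS-∷ʳ V a)) valid ,
         subst (λ G → letters G ↭ V ∷ʳ a) (sym (RS-∷ʳ V a))
               (↭-trans perm (↭-trans (prep a V-perm) (Perm.∷↭∷ʳ a V)))

length-RS : ∀ W → Unique W → length (labels (RS W)) ≡ length W
length-RS W u = length-labels (proj₁ (RS-valid W u))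

removeRoot-RS : ∀ V a → Unique (V ∷ʳ a) → removeRoot (suc (length V)) (RS (V ∷ʳ a)) ≡ just (a , RS V)
removeRoot-RS V a u =
  let (uV , a∉V) = Unique-∷ʳ⁻ V a u
      (V-valid , V-perm) = RS-valid V uV
  in trans (cong (removeRoot _) (RS-∷ʳ V a))
           (proj₂ (proj₂ (ins-step a V-valid (Perm.All-resp-↭ (↭-sym V-perm) a∉V))))

-- The last letter of W is the one stamped |W|, so it is recovered from RS W by removeRoot.
RS-injective : ∀ {W W′} → Unique W → Unique W′ → RS W ≡ RS W′ → W ≡ W′
RS-injective {W} {W′} = go (reverseView W) (reverseView W′)
  where
    go : ∀ {W W′} → Reverse W → Reverse W′ → Unique W → Unique W′ → RS W ≡ RS W′ → W ≡ W′
    go [] [] _ _ _ = refl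
    go [] (V′ ∶ _ ∶ʳ b) _ u′ e with trans (cong (removeRoot _) e) (removeRoot-RS V′ b u′)
    ... | ()
    go (V ∶ _ ∶ʳ a) [] u _ e with trans (cong (removeRoot _) (sym e)) (removeRoot-RS V a u)
    ... | ()
    go (V ∶ rV ∶ʳ a) (V′ ∶ rV′ ∶ʳ b) u u′ e =
      cong₂ _∷ʳ_ (go rV rV′ (proj₁ (Unique-∷ʳ⁻ V a u)) (proj₁ (Unique-∷ʳ⁻ V′ b u′)) (,-injectiveʳ same))
        (,-injectiveˡ same)
      where
        |V|≡|V′| : length V ≡ length V′
        |V|≡|V′| = ℕ.suc-injective (begin
          suc (length V)               ≡⟨ sym (length-∷ʳ V a) ⟩
          length (V ∷ʳ a)              ≡⟨ sym (length-RS (V ∷ʳ a) u) ⟩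
          length (labels (RS (V ∷ʳ a))) ≡⟨ cong (λ G → length (labels G)) e ⟩
          length (labels (RS (V′ ∷ʳ b))) ≡⟨ length-RS (V′ ∷ʳ b) u′ ⟩
          length (V′ ∷ʳ b)             ≡⟨ length-∷ʳ V′ b ⟩
          suc (length V′)              ∎)
          where open ≡-Reasoning
        same : (a , RS V) ≡ (b , RS V′)
        same = Maybe.just-injective (trans (sym (removeRoot-RS V a u))
                 (trans (cong₂ removeRoot (cong suc |V|≡|V′|) e) (removeRoot-RS V′ b u′)))

heap-stamps-< : ∀ t q → HeapOrdered t → Below (mapTree proj₂ t) q → All (λ y → proj₂ y ℕ.< q) (inorder t)
heap-stamps-< leaf q _ _ = []
heap-stamps-< (node l (_ , q′) r) q (hl , hr , l<q′ , r<q′) q′<q =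
  All.++⁺ (All.map (λ p → ℕ.<-trans p q′<q) (heap-stamps-< l q′ hl l<q′))
          (q′<q ∷ All.map (λ p → ℕ.<-trans p q′<q) (heap-stamps-< r q′ hr r<q′))

rootStamped : ∀ (Z : Forest PQ) q →
  All (λ b → HeapOrdered (proj₂ b)) Z → All (λ y → proj₂ y ℕ.≤ q) (labels Z) →
  Any (λ y → q ≡ proj₂ y) (labels Z) →
  Σ (Forest PQ) λ A → Σ ℤ λ s → Σ (Tree PQ) λ l → Σ Zbar λ a → Σ (Tree PQ) λ r → Σ (Forest PQ) λ C →
    Z ≡ glued A s l (a , q) r C
rootStamped [] q _ _ ()
rootStamped ((s , t) ∷ Z) q (_ ∷ hZ) ≤q q∈ with Any.++⁻ (inorder t) q∈
... | inj₂ q∈Z = let (A , rest) = rootStamped Z q hZ (All.++⁻ʳ (inorder t) ≤q) q∈Z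
                     (s′ , l , a , r , C , e) = rest
                 in (s , t) ∷ A , s′ , l , a , r , C , cong ((s , t) ∷_) e
rootStamped ((s , leaf) ∷ Z) q _ _ _ | inj₁ ()
rootStamped ((s , node l (a , q′) r) ∷ Z) q (ht ∷ _) ≤q _ | inj₁ q∈t =
  [] , s , l , a , r , Z , cong (λ p → (s , node l (a , p) r) ∷ Z) (ℕ.≤-antisym q′≤q q≤q′)
  where
    q′≤q : q′ ℕ.≤ q
    q′≤q = All.head (All.++⁻ʳ (inorder l) (All.++⁻ˡ (inorder (node l (a , q′) r)) ≤q))
    q≤q′ : q ℕ.≤ q′
    q≤q′ = let (y<q′+1 , q≡y) = All.lookupAny (heap-stamps-< (node l (a , q′) r) (suc q′) ht ℕ.≤-refl) q∈t
           in subst (ℕ._≤ q′) (sym q≡y) (ℕ.s≤s⁻¹ y<q′+1)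

valid-0-empty : ∀ {Z} → Valid 0 Z → Z ≡ []
valid-0-empty {[]} _ = refl
valid-0-empty {(s , leaf) ∷ Z} V = ⊥-elim (All.head (nonEmpty V))
valid-0-empty {(s , node l y r) ∷ Z} V =
  ⊥-elim (All.head (All.++⁻ʳ (inorder l) (All.++⁻ˡ (inorder l ++ y ∷ inorder r) no-labels)))
  where
    no-labels : All (λ _ → ⊥) (labels ((s , node l y r) ∷ Z))
    no-labels = All.map⁻ (Perm.All-resp-↭ (↭-sym (stamps-perm V)) [])

RS-surjective : ∀ m Z → Valid m Z → Σ (List Zbar) λ W → RS W ≡ Z × letters Z ↭ W
RS-surjective zero Z V with valid-0-empty V
... | refl = [] , refl , ↭-refl
RS-surjective (suc m) Z V with rootStamped Z (suc m) (heap V) (stamps-≤ V) top∈stamps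
  where
    top∈stamps = Any.map⁻ (Perm.Any-resp-↭ (↭-sym (stamps-perm V))
                   (Membership.∈-map⁺ suc (Membership.∈-applyUpTo⁺ (λ i → i) (ℕ.n<1+n m))))
... | A , s , l , a , r , C , refl with valid-unglue V
... | V′ , site with RS-surjective m _ V′
... | W , RS-W , perm = W ∷ʳ a , RS-W∷ʳa , ↭-trans (Perm.map⁺ proj₁ (labels-glued-↭ A s l (a , suc m) r C))
                                                  (↭-trans (prep a perm) (Perm.∷↭∷ʳ a W))
  where
    |W|≡m : length W ≡ m
    |W|≡m = trans (sym (Perm.↭-length perm))
                  (trans (List.length-map proj₁ (labels (unglued A s l r C))) (length-labels V′))
    RS-W∷ʳa : RS (W ∷ʳ a) ≡ glued A s l (a , suc m) r C
    RS-W∷ʳa = begin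
      RS (W ∷ʳ a)                          ≡⟨ RS-∷ʳ W a ⟩
      ins a (suc (length W)) (RS W)        ≡⟨ cong₂ (λ k G → ins a (suc k) G) |W|≡m RS-W ⟩
      ins a (suc m) (unglued A s l r C)    ≡⟨ ins-glue A s l r C a (suc m) site ⟩
      glued A s l (a , suc m) r C          ∎
      where open ≡-Reasoning

module _ {X Y : Set} (f : X → Y) where

  size-mapTree : ∀ t → size (mapTree f t) ≡ size t
  size-mapTree leaf = refl
  size-mapTree (node l _ r) = cong₂ (λ m n → m ℕ.+ suc n) (size-mapTree l) (size-mapTree r)

  inorder-mapTree : ∀ t → inorder (mapTree f t) ≡ map f (inorder t)
  inorder-mapTree leaf = refl
  inorder-mapTree (node l x r) = trans (cong₂ (λ u v → u ++ f x ∷ v) (inorder-mapTree l) (inorder-mapTree r))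
                                       (sym (List.map-++ f (inorder l) (x ∷ inorder r)))

  labels-mapForest : ∀ Z → labels (mapForest f Z) ≡ map f (labels Z)
  labels-mapForest [] = refl
  labels-mapForest ((s , t) ∷ Z) = trans (cong₂ _++_ (inorder-mapTree t) (labels-mapForest Z))
                                         (sym (List.map-++ f (inorder t) (labels Z)))

  nxt-mapBlock : ∀ (b : Block X) → nxt (proj₁ b , mapTree f (proj₂ b)) ≡ nxt b
  nxt-mapBlock (s , t) = cong (λ n → s ℤ.+ + n) (size-mapTree t)

  NonEmpty-mapForest⁺ : ∀ {Z} → All NonEmptyBlock Z → All NonEmptyBlock (mapForest f Z)
  NonEmpty-mapForest⁺ = All.map⁺ ∘ All.map (λ { {_ , node _ _ _} _ → tt })

  NonEmpty-mapForest⁻ : ∀ {Z} → All NonEmptyBlock (mapForest f Z) → All NonEmptyBlock Z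
  NonEmpty-mapForest⁻ = All.map (λ { {_ , node _ _ _} _ → tt }) ∘ All.map⁻

  ≺-mapForest⁺ : ∀ {Z} → AllPairs _≺_ Z → AllPairs _≺_ (mapForest f Z)
  ≺-mapForest⁺ = AllPairs.map⁺ ∘ AllPairs.map (λ {b} → subst (ℤ._< _) (sym (nxt-mapBlock b)))

  ≺-mapForest⁻ : ∀ {Z} → AllPairs _≺_ (mapForest f Z) → AllPairs _≺_ Z
  ≺-mapForest⁻ = AllPairs.map (λ {b} → subst (ℤ._< _) (nxt-mapBlock b)) ∘ AllPairs.map⁻

  shape-mapForest : ∀ Z → shape (mapForest f Z) ≡ shape Z
  shape-mapForest [] = refl
  shape-mapForest ((s , t) ∷ Z) = cong₂ (λ u Z′ → (s , u) ∷ Z′) (shape-mapTree t) (shape-mapForest Z)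
    where
      shape-mapTree : ∀ t → mapTree (λ _ → tt) (mapTree f t) ≡ mapTree (λ _ → tt) t
      shape-mapTree leaf = refl
      shape-mapTree (node l _ r) = cong₂ (λ u v → node u tt v) (shape-mapTree l) (shape-mapTree r)

module _ {X : Set} where

  AllPairs⇒Separated : ∀ {F : Forest X} → AllPairs _≺_ F → Separated F
  AllPairs⇒Separated [] = tt
  AllPairs⇒Separated (_ ∷ []) = tt
  AllPairs⇒Separated ((b≺b′ ∷ _) ∷ sep@(_ ∷ _)) = b≺b′ , AllPairs⇒Separated sep

  Separated⇒AllPairs : ∀ (F : Forest X) → Separated F → AllPairs _≺_ F
  Separated⇒AllPairs [] _ = []
  Separated⇒AllPairs (b ∷ []) _ = [] ∷ []
  Separated⇒AllPairs (b ∷ b′ ∷ F) (b≺b′ , sep) with Separated⇒AllPairs (b′ ∷ F) sep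
  ... | b′≺F ∷ sepF =
    (b≺b′ ∷ All.map (ℤ.<-trans (ℤ.<-≤-trans b≺b′ (start≤nxt b′))) b′≺F) ∷ b′≺F ∷ sepF


SearchTree⇒LBSTree : ∀ s t → SearchTree s t → LBSTree s (mapTree proj₁ t)
SearchTree⇒LBSTree s leaf _ = tt
SearchTree⇒LBSTree s (node l _ r) (sl , sr , rest) rewrite size-mapTree proj₁ l | size-mapTree proj₁ r =
  SearchTree⇒LBSTree s l sl , SearchTree⇒LBSTree _ r sr , rest

LBSTree⇒SearchTree : ∀ s t → LBSTree s (mapTree proj₁ t) → SearchTree s t
LBSTree⇒SearchTree s leaf _ = tt
LBSTree⇒SearchTree s (node l _ r) h rewrite size-mapTree proj₁ l | size-mapTree proj₁ r with h
... | sl , sr , rest = LBSTree⇒SearchTree s l sl , LBSTree⇒SearchTree _ r sr , rest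

HeapOrdered⇒HeapTree : ∀ t → HeapOrdered t → HeapTree (mapTree proj₂ t)
HeapOrdered⇒HeapTree leaf _ = tt
HeapOrdered⇒HeapTree (node l _ r) (hl , hr , below) = HeapOrdered⇒HeapTree l hl , HeapOrdered⇒HeapTree r hr , below

HeapTree⇒HeapOrdered : ∀ t → HeapTree (mapTree proj₂ t) → HeapOrdered t
HeapTree⇒HeapOrdered leaf _ = tt
HeapTree⇒HeapOrdered (node l _ r) (hl , hr , below) = HeapTree⇒HeapOrdered l hl , HeapTree⇒HeapOrdered r hr , below

Valid⇒ValidPair : ∀ {n Z} → Valid n Z → ValidPair (mapForest proj₁ Z) (mapForest proj₂ Z)
Valid⇒ValidPair {n} {Z} V =
  shape Z ,
  (NonEmpty-mapForest⁺ _ (nonEmpty V) , AllPairs⇒Separated (≺-mapForest⁺ _ (separated V))) ,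
  shape-mapForest proj₁ Z , shape-mapForest proj₂ Z ,
  (All.map⁺ (All.map (λ {b} → SearchTree⇒LBSTree (start b) (proj₂ b)) (search V)) ,
   subst Unique (sym (labels-mapForest proj₁ Z)) (letters-unique V)) ,
  (All.map⁺ (All.map (λ {b} → HeapOrdered⇒HeapTree (proj₂ b)) (heap V)) ,
   subst (λ ys → ys ↭ map suc (upTo (length ys))) (sym (labels-mapForest proj₂ Z))
         (subst (λ k → stamps Z ↭ map suc (upTo k)) (sym |stamps|≡n) (stamps-perm V)))
  where
    |stamps|≡n : length (stamps Z) ≡ n
    |stamps|≡n = trans (List.length-map proj₂ (labels Z)) (length-labels V)

ValidPair⇒Valid : ∀ Z → ValidPair (mapForest proj₁ Z) (mapForest proj₂ Z) → Valid (length (labels Z)) Z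
ValidPair⇒Valid Z (_ , (ne , sep) , refl , _ , (lbs , uniq) , (heapQ , permQ)) = record
  { nonEmpty = NonEmpty-mapForest⁻ proj₁ (NonEmpty-mapForest⁻ _ ne)
  ; separated = ≺-mapForest⁻ proj₁ (≺-mapForest⁻ _ (Separated⇒AllPairs _ sep))
  ; search = All.map (λ {b} → LBSTree⇒SearchTree (start b) (proj₂ b)) (All.map⁻ lbs)
  ; letters-unique = subst Unique (labels-mapForest proj₁ Z) uniq
  ; heap = All.map (λ {b} → HeapTree⇒HeapOrdered (proj₂ b)) (All.map⁻ heapQ)
  ; stamps-perm = subst (λ k → stamps Z ↭ map suc (upTo k)) (List.length-map proj₂ (labels Z))
                        (subst (λ ys → ys ↭ map suc (upTo (length ys))) (labels-mapForest proj₂ Z) permQ)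
  }

zipTree : Tree Zbar → Tree ℕ → Tree PQ
zipTree (node l a r) (node l′ q r′) = node (zipTree l l′) (a , q) (zipTree r r′)
zipTree _ _ = leaf

zipForest : Forest Zbar → Forest ℕ → Forest PQ
zipForest ((s , t) ∷ P) ((_ , t′) ∷ Q) = (s , zipTree t t′) ∷ zipForest P Q
zipForest _ _ = []

zipForest-mapForest : ∀ Z → zipForest (mapForest proj₁ Z) (mapForest proj₂ Z) ≡ Z
zipForest-mapForest [] = refl
zipForest-mapForest ((s , t) ∷ Z) = cong₂ (λ u Z′ → (s , u) ∷ Z′) (zipTree-mapTree t) (zipForest-mapForest Z)
  where
    zipTree-mapTree : ∀ t → zipTree (mapTree proj₁ t) (mapTree proj₂ t) ≡ t
    zipTree-mapTree leaf = refl
    zipTree-mapTree (node l x r) = cong₂ (λ u v → node u x v) (zipTree-mapTree l) (zipTree-mapTree r)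

mapForest-proj-injective : ∀ {F G} →
  mapForest proj₁ F ≡ mapForest proj₁ G → mapForest proj₂ F ≡ mapForest proj₂ G → F ≡ G
mapForest-proj-injective {F} {G} e₁ e₂ = begin
  F                                                   ≡⟨ sym (zipForest-mapForest F) ⟩
  zipForest (mapForest proj₁ F) (mapForest proj₂ F)   ≡⟨ cong₂ zipForest e₁ e₂ ⟩
  zipForest (mapForest proj₁ G) (mapForest proj₂ G)   ≡⟨ zipForest-mapForest G ⟩
  G                                                   ∎
  where open ≡-Reasoning

node-injective : ∀ {X : Set} {l l′ r r′ : Tree X} {x x′} →
  node l x r ≡ node l′ x′ r′ → l ≡ l′ × r ≡ r′
node-injective refl = refl , refl

unzipTree : ∀ t t′ → mapTree (λ _ → tt) t ≡ mapTree (λ _ → tt) t′ →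
  mapTree proj₁ (zipTree t t′) ≡ t × mapTree proj₂ (zipTree t t′) ≡ t′
unzipTree leaf leaf _ = refl , refl
unzipTree (node l a r) (node l′ q r′) e with node-injective e
... | el , er with unzipTree l l′ el | unzipTree r r′ er
... | el₁ , el₂ | er₁ , er₂ = cong₂ (λ u v → node u a v) el₁ er₁ , cong₂ (λ u v → node u q v) el₂ er₂

unzipForest : ∀ P Q → shape P ≡ shape Q → Σ (Forest PQ) λ Z → mapForest proj₁ Z ≡ P × mapForest proj₂ Z ≡ Q
unzipForest [] [] _ = [] , refl , refl
unzipForest ((s , t) ∷ P) ((s′ , t′) ∷ Q) e with List.∷-injective e
... | e-head , e-tail with unzipTree t t′ (cong proj₂ e-head) | unzipForest P Q e-tail
... | et₁ , et₂ | Z , refl , refl =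
  (s , zipTree t t′) ∷ Z ,
  cong (λ u → (s , u) ∷ _) et₁ , cong₂ (λ s″ u → (s″ , u) ∷ _) (cong proj₁ e-head) et₂

RS-onto : ∀ P Q → ValidPair P Q → Σ (List Zbar) λ W → Unique W × Pof W ≡ P × Qof W ≡ Q
RS-onto P Q vp@(_ , _ , P-shape , Q-shape , _) with unzipForest P Q (trans P-shape (sym Q-shape))
... | Z , refl , refl =
  let V = ValidPair⇒Valid Z vp
      (W , RS-W , perm) = RS-surjective _ Z V
  in W , Unique-resp-↭ perm (letters-unique V) , cong (mapForest proj₁) RS-W , cong (mapForest proj₂) RS-W

theorem5p1 :
    ((W : List Zbar) → Unique W → ValidPair (Pof W) (Qof W))
    × ((W W′ : List Zbar) → Unique W → Unique W′ →
         Pof W ≡ Pof W′ → Qof W ≡ Qof W′ → W ≡ W′)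
    × ((P : Forest Zbar) (Q : Forest ℕ) → ValidPair P Q →
         Σ (List Zbar) (λ W → Unique W × Pof W ≡ P × Qof W ≡ Q))
theorem5p1 =
  (λ W u → Valid⇒ValidPair (proj₁ (RS-valid W u))) ,
  (λ W W′ u u′ same-P same-Q → RS-injective u u′ (mapForest-proj-injective same-P same-Q)) ,
  RS-onto
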